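{- Let $k$ be a natural number and $\circ \in \{\land, \lor\}$. Then: (1) If $\varphi \in \Sigma_{k+1}^+$ and $\psi \in \Sigma_{k+1}^+$, then there is $\sigma \in \Sigma_{k+1}^+$ with $\varphi \circ \psi \rhd^* \sigma$. (2) If $\varphi \in \Pi_{k+1}^+$ and $\psi \in \Pi_{k+1}^+$, then there is $\pi \in \Pi_{k+1}^+$ with $\varphi \circ \psi \rhd^* \pi$. (3) If $\varphi \in \Pi_{k+1}^+$ and $\psi \in \Sigma_{k+1}^+$, then there is $\sigma \in \Sigma_{k+1}^+$ with $(\varphi \to \psi) \rhd^* \sigma$. (4) If $\varphi \in \Sigma_{k+1}^+$ and $\psi \in \Pi_{k+1}^+$, then there is $\pi \in \Pi_{k+1}^+$ with $(\varphi \to \psi) \rhd^* \pi$.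
   Context: Fix an arbitrary first-order language whose logical symbols are $\forall, \exists, \to, \land, \lor, \perp$; $\mathrm{FV}(\varphi)$ is the set of free variables of $\varphi$. Prenex classes: $\Sigma_0 = \Pi_0$ is the class of quantifier-free formulas; $\Sigma_{k+1}$ is the class of formulas $\exists x_1 \cdots \exists x_n \varphi$ with $n \geq 1$ and $\varphi \in \Pi_k$; $\Pi_{k+1}$ is the class of formulas $\forall x_1 \cdots \forall x_n \varphi$ with $n\ge 1$ and $\varphi \in \Sigma_k$. $\Sigma_k^+ = \Sigma_k \cup \bigcup_{i<k}(\Sigma_i \cup \Pi_i)$, $\Pi_k^+ = \Pi_k \cup \bigcup_{i<k}(\Sigma_i \cup \Pi_i)$. Prenex transformation: $\varphi\rhd\psi$ means that for some formulas $\xi,\delta$, a variable $x\notin\mathrm{FV}(\delta)$, a variable $y$ not occurring in $\xi$, and $Q\in\{\forall,\exists\}$, $(\varphi,\psi)$ is one of: $(\exists x\xi(x)\to\delta, \forall x(\xi(x)\to\delta))$; $(\forall x\xi(x)\to\delta, \exists x(\xi(x)\to\delta))$; $(\delta\to Qx\,\xi(x), Qx(\delta\to\xi(x)))$; $(Qx\,\xi(x)\land\delta, Qx(\xi(x)\land\delta))$; $(\delta\land Qx\,\xi(x), Qx(\delta\land\xi(x)))$; $(Qx\,\xi(x)\lor\delta, Qx(\xi(x)\lor\delta))$; $(\delta\lor Qx\,\xi(x), Qx(\delta\lor\xi(x)))$; $(Qx\,\xi(x), Qy\,\xi(y))$, with $\xi(y)$ the substitution of $y$ for free $x$. $\varphi\rhd^*\psi$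 means there are $m\ge0$ and $\varphi_0\equiv\varphi,\dots,\varphi_m\equiv\psi$ with each $\varphi_{i+1}$ obtained from $\varphi_i$ by replacing one occurrence of a subformula $\xi_i$ with $\delta_i$ where $\xi_i\rhd\delta_i$. -}

module Defs where

open import Data.Nat using (ℕ; zero; suc; _<_)
open import Data.Fin using (Fin)
open import Data.List using (List; []; _∷_; foldr)
open import Data.Product using (Σ; ∃; ∃-syntax; _×_; _,_)
open import Data.Sum using (_⊎_)
open import Relation.Nullary using (¬_; yes; no)
open import Relation.Binary.PropositionalEquality using (_≡_; _≢_)
open import Relation.Binary.Construct.Closure.ReflexiveTransitive using (Star)
open import Data.Nat using (_≟_)

record Language : Set₁ where
  field
    Func   : Set
    Pred   : Set
    farity : Func → ℕ
    parity : Pred → ℕ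

data Quant : Set where
  all ex : Quant

data BinConn : Set where
  and or : BinConn

module Syntax (L : Language) where
  open Language L

  data Term : Set where
    var : ℕ → Term
    fun : (f : Func) → (Fin (farity f) → Term) → Term

  infixr 5 _⇒_
  infixr 6 _∧'_ _∨'_

  data Formula : Set where
    atom  : (p : Pred) → (Fin (parity p) → Term) → Formula
    ⊥'    : Formula
    _⇒_   : Formula → Formula → Formula
    _∧'_  : Formula → Formula → Formula
    _∨'_  : Formula → Formula → Formula
    Qf    : Quant → ℕ → Formula → Formula

  conn : BinConn → Formula → Formula → Formula
  conn and φ ψ = φ ∧' ψ
  conn or  φ ψ = φ ∨' ψ

  data OccT (x : ℕ) : Term → Set where
    here : OccT x (var x)
    arg  : ∀ {f ts} (i : Fin (farity f)) → OccT x (ts i) → OccT x (fun f ts)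

  data Free (x : ℕ) : Formula → Set where
    atom : ∀ {p ts} (i : Fin (parity p)) → OccT x (ts i) → Free x (atom p ts)
    ⇒l : ∀ {φ ψ} → Free x φ → Free x (φ ⇒ ψ)
    ⇒r : ∀ {φ ψ} → Free x ψ → Free x (φ ⇒ ψ)
    ∧l : ∀ {φ ψ} → Free x φ → Free x (φ ∧' ψ)
    ∧r : ∀ {φ ψ} → Free x ψ → Free x (φ ∧' ψ)
    ∨l : ∀ {φ ψ} → Free x φ → Free x (φ ∨' ψ)
    ∨r : ∀ {φ ψ} → Free x ψ → Free x (φ ∨' ψ)
    q  : ∀ {Q z φ} → z ≢ x → Free x φ → Free x (Qf Q z φ)

  data Occurs (y : ℕ) : Formula → Set where
    atom : ∀ {p ts} (i : Fin (parity p)) → OccT y (ts i) → Occurs y (atom p ts)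
    ⇒l : ∀ {φ ψ} → Occurs y φ → Occurs y (φ ⇒ ψ)
    ⇒r : ∀ {φ ψ} → Occurs y ψ → Occurs y (φ ⇒ ψ)
    ∧l : ∀ {φ ψ} → Occurs y φ → Occurs y (φ ∧' ψ)
    ∧r : ∀ {φ ψ} → Occurs y ψ → Occurs y (φ ∧' ψ)
    ∨l : ∀ {φ ψ} → Occurs y φ → Occurs y (φ ∨' ψ)
    ∨r : ∀ {φ ψ} → Occurs y ψ → Occurs y (φ ∨' ψ)
    qv : ∀ {Q φ} → Occurs y (Qf Q y φ)
    q  : ∀ {Q z φ} → Occurs y φ → Occurs y (Qf Q z φ)

  renT : ℕ → ℕ → Term → Term
  renT x y (var z) with z ≟ x
  ... | yes _ = var y
  ... | no  _ = var z
  renT x y (fun f ts) = fun f (λ i → renT x y (ts i))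

  renF : ℕ → ℕ → Formula → Formula
  renF x y (atom p ts) = atom p (λ i → renT x y (ts i))
  renF x y ⊥' = ⊥'
  renF x y (φ ⇒ ψ) = renF x y φ ⇒ renF x y ψ
  renF x y (φ ∧' ψ) = renF x y φ ∧' renF x y ψ
  renF x y (φ ∨' ψ) = renF x y φ ∨' renF x y ψ
  renF x y (Qf Q z φ) with z ≟ x
  ... | yes _ = Qf Q z φ
  ... | no  _ = Qf Q z (renF x y φ)

  infix 4 _▷_
  data _▷_ : Formula → Formula → Set where
    ex⇒  : ∀ {x ξ δ} → ¬ Free x δ → (Qf ex x ξ ⇒ δ) ▷ Qf all x (ξ ⇒ δ)
    all⇒ : ∀ {x ξ δ} → ¬ Free x δ → (Qf all x ξ ⇒ δ) ▷ Qf ex x (ξ ⇒ δ)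
    ⇒Q   : ∀ {Q x ξ δ} → ¬ Free x δ → (δ ⇒ Qf Q x ξ) ▷ Qf Q x (δ ⇒ ξ)
    Q∧   : ∀ {Q x ξ δ} → ¬ Free x δ → (Qf Q x ξ ∧' δ) ▷ Qf Q x (ξ ∧' δ)
    ∧Q   : ∀ {Q x ξ δ} → ¬ Free x δ → (δ ∧' Qf Q x ξ) ▷ Qf Q x (δ ∧' ξ)
    Q∨   : ∀ {Q x ξ δ} → ¬ Free x δ → (Qf Q x ξ ∨' δ) ▷ Qf Q x (ξ ∨' δ)
    ∨Q   : ∀ {Q x ξ δ} → ¬ Free x δ → (δ ∨' Qf Q x ξ) ▷ Qf Q x (δ ∨' ξ)
    ren  : ∀ {Q x y ξ} → ¬ Occurs y ξ → Qf Q x ξ ▷ Qf Q y (renF x y ξ)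

  data Step : Formula → Formula → Set where
    top : ∀ {φ ψ} → φ ▷ ψ → Step φ ψ
    ⇒l : ∀ {φ φ' ψ} → Step φ φ' → Step (φ ⇒ ψ) (φ' ⇒ ψ)
    ⇒r : ∀ {φ ψ ψ'} → Step ψ ψ' → Step (φ ⇒ ψ) (φ ⇒ ψ')
    ∧l : ∀ {φ φ' ψ} → Step φ φ' → Step (φ ∧' ψ) (φ' ∧' ψ)
    ∧r : ∀ {φ ψ ψ'} → Step ψ ψ' → Step (φ ∧' ψ) (φ ∧' ψ')
    ∨l : ∀ {φ φ' ψ} → Step φ φ' → Step (φ ∨' ψ) (φ' ∨' ψ)
    ∨r : ∀ {φ ψ ψ'} → Step ψ ψ' → Step (φ ∨' ψ) (φ ∨' ψ')
    q  : ∀ {Q x φ φ'} → Step φ φ' → Step (Qf Q x φ) (Qf Q x φ')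

  infix 4 _▷*_
  _▷*_ : Formula → Formula → Set
  _▷*_ = Star Step

  data QF : Formula → Set where
    atom : ∀ {p ts} → QF (atom p ts)
    ⊥'   : QF ⊥'
    ⇒'   : ∀ {φ ψ} → QF φ → QF ψ → QF (φ ⇒ ψ)
    ∧''  : ∀ {φ ψ} → QF φ → QF ψ → QF (φ ∧' ψ)
    ∨''  : ∀ {φ ψ} → QF φ → QF ψ → QF (φ ∨' ψ)

  quants : Quant → List ℕ → Formula → Formula
  quants Q xs φ = foldr (Qf Q) φ xs

  Sig : ℕ → Formula → Set
  Pi  : ℕ → Formula → Set
  Sig zero    φ = QF φ
  Sig (suc k) φ = ∃[ x ] ∃[ xs ] ∃[ ψ ] (φ ≡ quants ex (x ∷ xs) ψ × Pi k ψ)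
  Pi  zero    φ = QF φ
  Pi  (suc k) φ = ∃[ x ] ∃[ xs ] ∃[ ψ ] (φ ≡ quants all (x ∷ xs) ψ × Sig k ψ)

  SigPlus : ℕ → Formula → Set
  SigPlus k φ = Sig k φ ⊎ ∃[ i ] (i < k × (Sig i φ ⊎ Pi i φ))

  PiPlus : ℕ → Formula → Set
  PiPlus k φ = Pi k φ ⊎ ∃[ i ] (i < k × (Sig i φ ⊎ Pi i φ))

-- Σₙ⁺ and Πₙ⁺ consist of the quantifier-free formulas closed under alternately prefixing
-- blocks of ∃ and ∀. Write φ = Q x̄ A and ψ = Q ȳ B with matrices A, B one level
-- lower and of dual polarity. Renaming each bound variable to one occurring in neither side
-- lets the prefix of φ, then that of ψ, be pulled out of φ ∘ ψ one quantifier at a time;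
-- pulling out of an antecedent dualises the quantifier, which is why (3) and (4) mix Σ and Π.
-- What remains is A ∘ B, which is handled by induction on n.
module Submission where

open import Defs
open import Data.Nat using (ℕ; _≟_; zero; suc; _≤_; _<_; _⊔_; _≤′_; ≤′-refl; ≤′-step)
open import Data.Nat.Properties
  using (≤-trans; <-≤-trans; ≤⇒≯; ≤⇒≤′; m≤n⇒m<n∨m≡n; m<n⇒m<1+n; n<1+n; m≤m⊔n; m≤n⊔m; m<n⇒m<n⊔o; m<n⇒m<o⊔n)
open import Data.Fin using (Fin) renaming (zero to fzero; suc to fsuc)
open import Data.List using ([]; _∷_)
open import Data.Product using (_×_; ∃-syntax; _,_)
open import Data.Sum using (_⊎_; inj₁; inj₂)
open import Function using (id; _∘_)
open import Relation.Nullary using (¬_; yes; no)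
open import Relation.Binary.PropositionalEquality using (_≡_; refl; cong; subst)
open import Relation.Binary.Construct.Closure.ReflexiveTransitive using (ε; _◅_; _◅◅_; gmap)

dual : Quant → Quant
dual all = ex
dual ex  = all

data Conn : Set where
  bin : BinConn → Conn
  imp : Conn

data Side : Set where
  left right : Side

-- The quantifier that turns into Q when it is pulled out of the given side of c.
source : Side → Conn → Quant → Quant
source left  imp     = dual
source left  (bin _) = id
source right _       = id

dual-source : ∀ c Q → dual (source left c Q) ≡ source left c (dual Q)
dual-source (bin _) Q = refl
dual-source imp     Q = refl

⨆ : ∀ n → (Fin n → ℕ) → ℕ
⨆ zero    f = 0
⨆ (suc n) f = f fzero ⊔ ⨆ n (f ∘ fsuc)

≤-⨆ : ∀ {n} (f : Fin n → ℕ) i → f i ≤ ⨆ n f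
≤-⨆ f fzero    = m≤m⊔n _ _
≤-⨆ f (fsuc i) = ≤-trans (≤-⨆ (f ∘ fsuc) i) (m≤n⊔m _ _)

module Prenexing (L : Language) where
  open Language L
  open Syntax L

  apply : Conn → Formula → Formula → Formula
  apply (bin c) = conn c
  apply imp     = _⇒_

  plug : Conn → Side → Formula → Formula → Formula
  plug c left  δ φ = apply c φ δ
  plug c right δ φ = apply c δ φ

  varBoundᵗ : Term → ℕ
  varBoundᵗ (var z)    = suc z
  varBoundᵗ (fun f ts) = ⨆ (farity f) (λ i → varBoundᵗ (ts i))

  varBound : Formula → ℕ
  varBound (atom p ts) = ⨆ (parity p) (λ i → varBoundᵗ (ts i))
  varBound ⊥'          = 0
  varBound (φ ⇒ ψ)     = varBound φ ⊔ varBound ψ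
  varBound (φ ∧' ψ)    = varBound φ ⊔ varBound ψ
  varBound (φ ∨' ψ)    = varBound φ ⊔ varBound ψ
  varBound (Qf Q z φ)  = suc z ⊔ varBound φ

  occT⇒<varBoundᵗ : ∀ {y t} → OccT y t → y < varBoundᵗ t
  occT⇒<varBoundᵗ here                = n<1+n _
  occT⇒<varBoundᵗ (arg {ts = ts} i o) =
    <-≤-trans (occT⇒<varBoundᵗ o) (≤-⨆ (λ j → varBoundᵗ (ts j)) i)

  occurs⇒<varBound : ∀ {y φ} → Occurs y φ → y < varBound φ
  occurs⇒<varBound (atom {ts = ts} i o) =
    <-≤-trans (occT⇒<varBoundᵗ o) (≤-⨆ (λ j → varBoundᵗ (ts j)) i)
  occurs⇒<varBound (⇒l o) = m<n⇒m<n⊔o _ (occurs⇒<varBound o)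
  occurs⇒<varBound (⇒r o) = m<n⇒m<o⊔n _ (occurs⇒<varBound o)
  occurs⇒<varBound (∧l o) = m<n⇒m<n⊔o _ (occurs⇒<varBound o)
  occurs⇒<varBound (∧r o) = m<n⇒m<o⊔n _ (occurs⇒<varBound o)
  occurs⇒<varBound (∨l o) = m<n⇒m<n⊔o _ (occurs⇒<varBound o)
  occurs⇒<varBound (∨r o) = m<n⇒m<o⊔n _ (occurs⇒<varBound o)
  occurs⇒<varBound {φ = Qf _ _ φ} qv = m≤m⊔n _ (varBound φ)
  occurs⇒<varBound (q o)  = m<n⇒m<o⊔n _ (occurs⇒<varBound o)

  free⇒occurs : ∀ {y φ} → Free y φ → Occurs y φ
  free⇒occurs (atom i o) = atom i o
  free⇒occurs (⇒l f)     = ⇒l (free⇒occurs f)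
  free⇒occurs (⇒r f)     = ⇒r (free⇒occurs f)
  free⇒occurs (∧l f)     = ∧l (free⇒occurs f)
  free⇒occurs (∧r f)     = ∧r (free⇒occurs f)
  free⇒occurs (∨l f)     = ∨l (free⇒occurs f)
  free⇒occurs (∨r f)     = ∨r (free⇒occurs f)
  free⇒occurs (q _ f)    = q (free⇒occurs f)

  fresh : Formula → Formula → ℕ
  fresh φ δ = varBound φ ⊔ varBound δ

  fresh-∉ˡ : ∀ φ δ → ¬ Occurs (fresh φ δ) φ
  fresh-∉ˡ φ δ o = ≤⇒≯ (m≤m⊔n (varBound φ) _) (occurs⇒<varBound o)

  fresh-∉ʳ : ∀ φ δ → ¬ Free (fresh φ δ) δ
  fresh-∉ʳ φ δ f = ≤⇒≯ (m≤n⊔m _ (varBound δ)) (occurs⇒<varBound (free⇒occurs f))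

  RenamingClosed : (Formula → Set) → Set
  RenamingClosed P = ∀ {x y φ} → P φ → P (renF x y φ)

  renF-quants : ∀ {P} → RenamingClosed P → ∀ x y Q xs {A} → P A →
    ∃[ A' ] (P A' × renF x y (quants Q xs A) ≡ quants Q xs A')
  renF-quants closed x y Q []       pA = _ , closed pA , refl
  renF-quants closed x y Q (z ∷ xs) pA with z ≟ x
  ... | yes _ = _ , pA , refl
  ... | no  _ with renF-quants closed x y Q xs pA
  ...   | A' , pA' , eq = A' , pA' , cong (Qf Q z) eq

  quants-▷* : ∀ Q xs {φ ψ} → φ ▷* ψ → quants Q xs φ ▷* quants Q xs ψ
  quants-▷* Q []       st = st
  quants-▷* Q (x ∷ xs) st = gmap _ q (quants-▷* Q xs st)

  plug-step : ∀ c s {δ φ ψ} → Step φ ψ → Step (plug c s δ φ) (plug c s δ ψ)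
  plug-step (bin and) left  st = ∧l st
  plug-step (bin or)  left  st = ∨l st
  plug-step imp       left  st = ⇒l st
  plug-step (bin and) right st = ∧r st
  plug-step (bin or)  right st = ∨r st
  plug-step imp       right st = ⇒r st

  pull-▷ : ∀ c s {Q x ξ δ} → ¬ Free x δ →
    plug c s δ (Qf (source s c Q) x ξ) ▷ Qf Q x (plug c s δ ξ)
  pull-▷ (bin and) left        x∉δ = Q∧ x∉δ
  pull-▷ (bin or)  left        x∉δ = Q∨ x∉δ
  pull-▷ imp       left  {all} x∉δ = ex⇒ x∉δ
  pull-▷ imp       left  {ex}  x∉δ = all⇒ x∉δ
  pull-▷ (bin and) right       x∉δ = ∧Q x∉δ
  pull-▷ (bin or)  right       x∉δ = ∨Q x∉δ
  pull-▷ imp       right       x∉δ = ⇒Q x∉δ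

  -- Each bound variable is first renamed apart from δ, which licenses pulling it across.
  pull-prefix : ∀ {P} → RenamingClosed P → ∀ c s Q xs {A} δ → P A →
    ∃[ xs' ] ∃[ A' ] (P A' × plug c s δ (quants (source s c Q) xs A) ▷* quants Q xs' (plug c s δ A'))
  pull-prefix closed c s Q []       δ pA = [] , _ , pA , ε
  pull-prefix closed c s Q (x ∷ xs) {A} δ pA
    with renF-quants closed x (fresh (quants (source s c Q) xs A) δ) (source s c Q) xs pA
  ... | A* , pA* , eq with pull-prefix closed c s Q xs δ pA*
  ...   | xs' , A' , pA' , st = y ∷ xs' , A' , pA' , rename ◅ pull ◅ gmap (Qf Q y) q st
    where
    Q₀ = source s c Q
    ξ  = quants Q₀ xs A
    y  = fresh ξ δ
    rename : Step (plug c s δ (Qf Q₀ x ξ)) (plug c s δ (Qf Q₀ y (quants Q₀ xs A*)))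
    rename = subst (λ χ → Step (plug c s δ (Qf Q₀ x ξ)) (plug c s δ (Qf Q₀ y χ))) eq
                   (plug-step c s (top (ren (fresh-∉ˡ ξ δ))))
    pull : Step (plug c s δ (Qf Q₀ y (quants Q₀ xs A*))) (Qf Q y (plug c s δ (quants Q₀ xs A*)))
    pull = top (pull-▷ c s (fresh-∉ʳ ξ δ))

  -- Prenex ex n and Prenex all n are Σₙ⁺ and Πₙ⁺, presented inductively.
  data Prenex : Quant → ℕ → Formula → Set where
    qf    : ∀ {Q φ} → QF φ → Prenex Q zero φ
    alt   : ∀ {Q m φ} → Prenex (dual Q) m φ → Prenex Q (suc m) φ
    quant : ∀ {Q m x φ} → Prenex Q (suc m) φ → Prenex Q (suc m) (Qf Q x φ)

  QF-apply : ∀ c {φ ψ} → QF φ → QF ψ → QF (apply c φ ψ)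
  QF-apply (bin and) = ∧''
  QF-apply (bin or)  = ∨''
  QF-apply imp       = ⇒'

  QF-renF : ∀ {x y φ} → QF φ → QF (renF x y φ)
  QF-renF atom      = atom
  QF-renF ⊥'        = ⊥'
  QF-renF (⇒' a b)  = ⇒' (QF-renF a) (QF-renF b)
  QF-renF (∧'' a b) = ∧'' (QF-renF a) (QF-renF b)
  QF-renF (∨'' a b) = ∨'' (QF-renF a) (QF-renF b)

  Prenex-renF : ∀ {Q n} → RenamingClosed (Prenex Q n)
  Prenex-renF         (qf a)              = qf (QF-renF a)
  Prenex-renF         (alt p)             = alt (Prenex-renF p)
  Prenex-renF {x = x} (quant {x = z} p) with z ≟ x
  ... | yes _ = quant p
  ... | no  _ = quant (Prenex-renF p)

  Prenex-quants : ∀ {Q m} xs {φ} → Prenex Q (suc m) φ → Prenex Q (suc m) (quants Q xs φ)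
  Prenex-quants []       p = p
  Prenex-quants (x ∷ xs) p = quant (Prenex-quants xs p)

  prefix-view : ∀ {Q m φ} → Prenex Q (suc m) φ →
    ∃[ xs ] ∃[ A ] (φ ≡ quants Q xs A × Prenex (dual Q) m A)
  prefix-view (alt p) = [] , _ , refl , p
  prefix-view (quant {x = x} p) with prefix-view p
  ... | xs , A , refl , pA = x ∷ xs , A , refl , pA

  Prenex-apply : ∀ n c Q {φ ψ} → Prenex (source left c Q) n φ → Prenex Q n ψ →
    ∃[ σ ] (Prenex Q n σ × apply c φ ψ ▷* σ)
  Prenex-apply zero c Q (qf a) (qf b) = _ , qf (QF-apply c a b) , ε
  Prenex-apply (suc m) c Q pφ pψ with prefix-view pφ | prefix-view pψ
  ... | xs , A , refl , pA | ys , B , refl , pB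
    with pull-prefix Prenex-renF c left Q xs (quants Q ys B) (subst (λ Q' → Prenex Q' m A) (dual-source c Q) pA)
  ... | xs' , A' , pA' , st₁ with pull-prefix Prenex-renF c right Q ys A' pB
  ... | ys' , B' , pB' , st₂ with Prenex-apply m c (dual Q) pA' pB'
  ... | σ , pσ , st₃ =
    quants Q xs' (quants Q ys' σ) ,
    Prenex-quants xs' (Prenex-quants ys' (alt pσ)) ,
    st₁ ◅◅ quants-▷* Q xs' (st₂ ◅◅ quants-▷* Q ys' st₃)

  Exact : Quant → ℕ → Formula → Set
  Exact ex  = Sig
  Exact all = Pi

  -- Plus ex and Plus all unfold definitionally to SigPlus and PiPlus.
  Plus : Quant → ℕ → Formula → Set
  Plus Q n φ = Exact Q n φ ⊎ ∃[ i ] (i < n × (Sig i φ ⊎ Pi i φ))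

  exact-either : ∀ Q {i φ} → Exact Q i φ → Sig i φ ⊎ Pi i φ
  exact-either ex  = inj₁
  exact-either all = inj₂

  exact-zero : ∀ Q {φ} → QF φ → Exact Q zero φ
  exact-zero ex  = id
  exact-zero all = id

  exact-quant : ∀ Q {m x φ} → Exact Q (suc m) φ → Exact Q (suc m) (Qf Q x φ)
  exact-quant ex  (y , ys , ψ , refl , p) = _ , y ∷ ys , ψ , refl , p
  exact-quant all (y , ys , ψ , refl , p) = _ , y ∷ ys , ψ , refl , p

  exact⇒prenex : ∀ Q n {φ} → Exact Q n φ → Prenex Q n φ
  exact⇒prenex ex  zero    a                       = qf a
  exact⇒prenex all zero    a                       = qf a
  exact⇒prenex ex  (suc n) (x , xs , ψ , refl , p) = Prenex-quants (x ∷ xs) (alt (exact⇒prenex all n p))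
  exact⇒prenex all (suc n) (x , xs , ψ , refl , p) = Prenex-quants (x ∷ xs) (alt (exact⇒prenex ex n p))

  Prenex-suc : ∀ Q' {Q i φ} → Prenex Q i φ → Prenex Q' (suc i) φ
  Prenex-suc Q'  (qf a)              = alt (qf a)
  Prenex-suc Q'  (alt p)             = alt (Prenex-suc (dual Q') p)
  Prenex-suc ex  (quant {Q = ex}  p) = quant (Prenex-suc ex p)
  Prenex-suc all (quant {Q = all} p) = quant (Prenex-suc all p)
  Prenex-suc ex  (quant {Q = all} p) = alt (quant p)
  Prenex-suc all (quant {Q = ex}  p) = alt (quant p)

  Prenex-≤′ : ∀ {Q i n φ} → i ≤′ n → Prenex Q i φ → Prenex Q n φ
  Prenex-≤′ ≤′-refl      p = p
  Prenex-≤′ (≤′-step le) p = Prenex-suc _ (Prenex-≤′ le p)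

  Prenex-< : ∀ {Q Q' i n φ} → i < n → Prenex Q' i φ → Prenex Q n φ
  Prenex-< lt p = Prenex-≤′ (≤⇒≤′ lt) (Prenex-suc _ p)

  plus⇒prenex : ∀ Q n {φ} → Plus Q n φ → Prenex Q n φ
  plus⇒prenex Q n (inj₁ e)                 = exact⇒prenex Q n e
  plus⇒prenex Q n (inj₂ (i , lt , inj₁ s)) = Prenex-< lt (exact⇒prenex ex i s)
  plus⇒prenex Q n (inj₂ (i , lt , inj₂ p)) = Prenex-< lt (exact⇒prenex all i p)

  exact⇒plus : ∀ Q {i n φ} → i ≤ n → Exact Q i φ → Plus Q n φ
  exact⇒plus Q le e with m≤n⇒m<n∨m≡n le
  ... | inj₁ lt   = inj₂ (_ , lt , exact-either Q e)
  ... | inj₂ refl = inj₁ e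

  -- Prefixing Q x keeps the level unless it starts a new block of quantifiers.
  quant-plus : ∀ Q Q' {i n x φ} → i < n → Exact Q' i φ → Plus Q n (Qf Q x φ)
  quant-plus ex  ex  {suc i} lt e = inj₂ (suc i , lt , inj₁ (exact-quant ex e))
  quant-plus all all {suc i} lt e = inj₂ (suc i , lt , inj₂ (exact-quant all e))
  quant-plus ex  ex  {zero}  lt e = exact⇒plus ex  lt (_ , [] , _ , refl , e)
  quant-plus all all {zero}  lt e = exact⇒plus all lt (_ , [] , _ , refl , e)
  quant-plus ex  all         lt e = exact⇒plus ex  lt (_ , [] , _ , refl , e)
  quant-plus all ex          lt e = exact⇒plus all lt (_ , [] , _ , refl , e)

  prenex⇒plus : ∀ {Q n φ} → Prenex Q n φ → Plus Q n φ
  prenex⇒plus {Q} (qf a) = inj₁ (exact-zero Q a)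
  prenex⇒plus {Q} (alt p) with prenex⇒plus p
  ... | inj₁ e            = inj₂ (_ , n<1+n _ , exact-either (dual Q) e)
  ... | inj₂ (i , lt , s) = inj₂ (i , m<n⇒m<1+n lt , s)
  prenex⇒plus {Q} (quant p) with prenex⇒plus p
  ... | inj₁ e                 = inj₁ (exact-quant Q e)
  ... | inj₂ (i , lt , inj₁ s) = quant-plus Q ex  lt s
  ... | inj₂ (i , lt , inj₂ s) = quant-plus Q all lt s

  Plus-apply : ∀ n c Q {φ ψ} → Plus (source left c Q) n φ → Plus Q n ψ →
    ∃[ σ ] (Plus Q n σ × apply c φ ψ ▷* σ)
  Plus-apply n c Q pφ pψ with Prenex-apply n c Q (plus⇒prenex _ n pφ) (plus⇒prenex Q n pψ)
  ... | σ , pσ , st = σ , prenex⇒plus pσ , st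

lemma4p2 : (L : Language) → let open Syntax L in
    (k : ℕ) (c : BinConn) →
      (∀ φ ψ → SigPlus (suc k) φ → SigPlus (suc k) ψ →
         ∃[ σ ] (SigPlus (suc k) σ × (conn c φ ψ ▷* σ)))
    × (∀ φ ψ → PiPlus (suc k) φ → PiPlus (suc k) ψ →
         ∃[ π ] (PiPlus (suc k) π × (conn c φ ψ ▷* π)))
    × (∀ φ ψ → PiPlus (suc k) φ → SigPlus (suc k) ψ →
         ∃[ σ ] (SigPlus (suc k) σ × ((φ ⇒ ψ) ▷* σ)))
    × (∀ φ ψ → SigPlus (suc k) φ → PiPlus (suc k) ψ →
         ∃[ π ] (PiPlus (suc k) π × ((φ ⇒ ψ) ▷* π)))
lemma4p2 L k c =
    (λ _ _ → Plus-apply (suc k) (bin c) ex)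
  , (λ _ _ → Plus-apply (suc k) (bin c) all)
  , (λ _ _ → Plus-apply (suc k) imp ex)
  , (λ _ _ → Plus-apply (suc k) imp all)
  where open Prenexing L
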